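{- In the setting below, for every $i\in I$, every point $p$, lines $m_1,m_2$ and points $d_1,d_2$: if $p$ lies on $m_1$ and $m_2$, $d_1$ lies on $m_1$, $d_2$ lies on $m_2$, $m_1,m_2\in B''_i$ and $d_1,d_2\notin B'_i$, then there is a line $n$ through $d_1$ and $d_2$. Dually, for every $i$, line $n$, points $d_1,d_2$ and lines $m_1,m_2$: if $d_1,d_2$ lie on $n$, $d_1$ lies on $m_1$, $d_2$ lies on $m_2$, $d_1,d_2\in B'_i$ and $m_1,m_2\notin B''_i$, then there is a point lying on both $m_1$ and $m_2$.
   Context: Let $\mathfrak M=\langle M,\mathcal L,\mathrm I\rangle$ be a connected partial linear space (PLS: $M\cap\mathcal L=\emptyset$, every line on at least two points, every point on at least two lines, two distinct points on at most one common line; connected: collinearity graph connected). A substructure $\langle B',B''\rangle$ is closed if any line through two distinct points of $B'$ is in $B''$ and any point on two distinct lines of $B''$ is in $B'$. Let $\{B_i=\langle B'_i,B''_i\rangle: i\in I\}$ be a family of connected closed substructures with $\bigcup B'_i=M$, $\bigcup B''_i=\mathcal L$, satisfying: (1) $B'_{i_1}\cap B'_{i_2}\ne\emptyset\Rightarrow B'_{i_1}=B'_{i_2}$; (2) $B''_{i_1}\cap B''_{i_2}\ne\emptyset\Rightarrow B''_{i_1}=B''_{i_2}$; (3) for each $i$ and $d\in B'_i$ some line $m\notin B''_i$ passes through $d$; (4) for each $i$ and $m\in B''_i$ some point $d\notin B'_i$ lies on $m$; (5) for each $i$, $\langle M\setminus B'_i,\mathcal L\setminus B''_i\rangle$ is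 a closed substructure; (6) for each $i$, point $p$, lines $m_1,m_2,m_3$ through $p$, and points $d_k$ on $m_k$ with $d_1,d_2,d_3\notin B'_i$: some line contains $d_1,d_2,d_3$, or some $m_k\notin B''_i$; (7) for each $i$, line $n$, points $d_1,d_2,d_3$ on $n$ and lines $m_k$ through $d_k$ with $m_1,m_2,m_3\notin B''_i$: some point lies on $m_1,m_2,m_3$, or some $d_k\notin B'_i$. -}

module Defs where

open import Level using (Level; _⊔_; suc)
open import Data.Product using (Σ; ∃; ∃-syntax; _×_; _,_)
open import Data.Sum using (_⊎_)
open import Data.Nat using (ℕ; zero; suc)
open import Data.List using (List; []; _∷_)
open import Relation.Nullary using (¬_)
open import Relation.Binary.PropositionalEquality using (_≡_)

record IncStr (a b c : Level) : Set (Level.suc (a ⊔ b ⊔ c)) where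
  field
    Pt  : Set a
    Ln  : Set b
    _I_ : Pt → Ln → Set c

module _ {a b c : Level} (S : IncStr a b c) where
  open IncStr S

  collinear : Pt → Pt → Set (b ⊔ c)
  collinear p q = ∃[ l ] (p I l × q I l)

  record IsPLS : Set (a ⊔ b ⊔ c) where
    field
      line-two-points : ∀ l → ∃[ p ] ∃[ q ] (¬ p ≡ q × p I l × q I l)
      point-two-lines : ∀ p → ∃[ l ] ∃[ k ] (¬ l ≡ k × p I l × p I k)
      unique-line : ∀ p q l k → ¬ p ≡ q → p I l → q I l → p I k → q I k → l ≡ k

  data Path : Pt → Pt → Set (a ⊔ b ⊔ c) where
    here : ∀ {p} → Path p p
    step : ∀ {p q r} → collinear p q → Path q r → Path p r

  Closed : ∀ {ℓ₁ ℓ₂} → (Pt → Set ℓ₁) → (Ln → Set ℓ₂) → Set (a ⊔ b ⊔ c ⊔ ℓ₁ ⊔ ℓ₂)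
  Closed B' B'' =
    (∀ p q l → ¬ p ≡ q → B' p → B' q → p I l → q I l → B'' l) ×
    (∀ p l k → ¬ l ≡ k → B'' l → B'' k → p I l → p I k → B' p)

  data SubPath {ℓ₁ ℓ₂} (B' : Pt → Set ℓ₁) (B'' : Ln → Set ℓ₂) : Pt → Pt → Set (a ⊔ b ⊔ c ⊔ ℓ₁ ⊔ ℓ₂) where
    here : ∀ {p} → SubPath B' B'' p p
    step : ∀ {p q r} → (l : Ln) → B'' l → p I l → q I l → B' q → SubPath B' B'' q r → SubPath B' B'' p r

  SubConnected : ∀ {ℓ₁ ℓ₂} → (Pt → Set ℓ₁) → (Ln → Set ℓ₂) → Set (a ⊔ b ⊔ c ⊔ ℓ₁ ⊔ ℓ₂)
  SubConnected B' B'' = ∀ p q → B' p → B' q → SubPath B' B'' p q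

  Connected : Set (a ⊔ b ⊔ c)
  Connected = ∀ p q → Path p q

  Compl' : ∀ {ℓ} → (Pt → Set ℓ) → Pt → Set ℓ
  Compl' B' p = ¬ B' p

  Compl'' : ∀ {ℓ} → (Ln → Set ℓ) → Ln → Set ℓ
  Compl'' B'' l = ¬ B'' l

  record Family {ι ℓ₁ ℓ₂ : Level} (Idx : Set ι)
                (B' : Idx → Pt → Set ℓ₁) (B'' : Idx → Ln → Set ℓ₂)
                : Set (a ⊔ b ⊔ c ⊔ ι ⊔ ℓ₁ ⊔ ℓ₂) where
    field
      closed    : ∀ i → Closed (B' i) (B'' i)
      connected : ∀ i → SubConnected (B' i) (B'' i)
      cover-pt  : ∀ p → ∃[ i ] B' i p
      cover-ln  : ∀ l → ∃[ i ] B'' i l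
      cond1 : ∀ i j → (∃[ p ] (B' i p × B' j p)) → ∀ p → (B' i p → B' j p) × (B' j p → B' i p)
      cond2 : ∀ i j → (∃[ l ] (B'' i l × B'' j l)) → ∀ l → (B'' i l → B'' j l) × (B'' j l → B'' i l)
      cond3 : ∀ i d → B' i d → ∃[ m ] (¬ B'' i m × d I m)
      cond4 : ∀ i m → B'' i m → ∃[ d ] (¬ B' i d × d I m)
      cond5 : ∀ i → Closed (Compl' (B' i)) (Compl'' (B'' i))
      cond6 : ∀ i p m₁ m₂ m₃ d₁ d₂ d₃ →
                p I m₁ → p I m₂ → p I m₃ →
                d₁ I m₁ → d₂ I m₂ → d₃ I m₃ →
                ¬ B' i d₁ → ¬ B' i d₂ → ¬ B' i d₃ →
                (∃[ n ] (d₁ I n × d₂ I n × d₃ I n)) ⊎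
                (¬ B'' i m₁ ⊎ ¬ B'' i m₂ ⊎ ¬ B'' i m₃)
      cond7 : ∀ i n d₁ d₂ d₃ m₁ m₂ m₃ →
                d₁ I n → d₂ I n → d₃ I n →
                d₁ I m₁ → d₂ I m₂ → d₃ I m₃ →
                ¬ B'' i m₁ → ¬ B'' i m₂ → ¬ B'' i m₃ →
                (∃[ p ] (p I m₁ × p I m₂ × p I m₃)) ⊎
                (¬ B' i d₁ ⊎ ¬ B' i d₂ ⊎ ¬ B' i d₃)

module Submission where

open import Defs
open import Level using (Level)
open import Data.Empty using (⊥-elim)
open import Data.Product using (∃-syntax; _×_; _,_)
open import Data.Sum using (_⊎_; inj₁; inj₂; fromInj₁)
open import Function using (_∘_)
open import Relation.Nullary using (¬_)

-- Conditions (6) and (7) quantify over three lines (resp. points); the pair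
-- versions follow by taking the third one equal to the first.

none-refuted : ∀ {p q r} {P : Set p} {Q : Set q} {R : Set r} →
               P → Q → R → ¬ (¬ P ⊎ ¬ Q ⊎ ¬ R)
none-refuted p q r (inj₁ ¬p)        = ¬p p
none-refuted p q r (inj₂ (inj₁ ¬q)) = ¬q q
none-refuted p q r (inj₂ (inj₂ ¬r)) = ¬r r

module _ {a b c ι ℓ₁ ℓ₂ : Level} {S : IncStr a b c} {Idx : Set ι}
         {B' : Idx → IncStr.Pt S → Set ℓ₁} {B'' : Idx → IncStr.Ln S → Set ℓ₂}
         (F : Family S Idx B' B'') where

  open IncStr S
  open Family F

  outer-points-collinear : ∀ i p m₁ m₂ d₁ d₂ →
    p I m₁ → p I m₂ → d₁ I m₁ → d₂ I m₂ →
    B'' i m₁ → B'' i m₂ → ¬ B' i d₁ → ¬ B' i d₂ →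
    ∃[ n ] (d₁ I n × d₂ I n)
  outer-points-collinear i p m₁ m₂ d₁ d₂ pm₁ pm₂ dm₁ dm₂ b₁ b₂ nd₁ nd₂
    with fromInj₁ (⊥-elim ∘ none-refuted b₁ b₂ b₁)
           (cond6 i p m₁ m₂ m₁ d₁ d₂ d₁ pm₁ pm₂ pm₁ dm₁ dm₂ dm₁ nd₁ nd₂ nd₁)
  ... | n , d₁n , d₂n , _ = n , d₁n , d₂n

  outer-lines-concurrent : ∀ i n d₁ d₂ m₁ m₂ →
    d₁ I n → d₂ I n → d₁ I m₁ → d₂ I m₂ →
    B' i d₁ → B' i d₂ → ¬ B'' i m₁ → ¬ B'' i m₂ →
    ∃[ p ] (p I m₁ × p I m₂)
  outer-lines-concurrent i n d₁ d₂ m₁ m₂ dn₁ dn₂ dm₁ dm₂ b₁ b₂ nm₁ nm₂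
    with fromInj₁ (⊥-elim ∘ none-refuted b₁ b₂ b₁)
           (cond7 i n d₁ d₂ d₁ m₁ m₂ m₁ dn₁ dn₂ dn₁ dm₁ dm₂ dm₁ nm₁ nm₂ nm₁)
  ... | p , pm₁ , pm₂ , _ = p , pm₁ , pm₂

lemma3p2 : ∀ {a b c ι ℓ₁ ℓ₂ : Level} (S : IncStr a b c) → IsPLS S → Connected S →
    ∀ (Idx : Set ι) (B' : Idx → IncStr.Pt S → Set ℓ₁) (B'' : Idx → IncStr.Ln S → Set ℓ₂) →
    Family S Idx B' B'' →
    (∀ i p m₁ m₂ d₁ d₂ →
      IncStr._I_ S p m₁ → IncStr._I_ S p m₂ →
      IncStr._I_ S d₁ m₁ → IncStr._I_ S d₂ m₂ →
      B'' i m₁ → B'' i m₂ → ¬ B' i d₁ → ¬ B' i d₂ →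
      ∃[ n ] (IncStr._I_ S d₁ n × IncStr._I_ S d₂ n))
    ×
    (∀ i n d₁ d₂ m₁ m₂ →
      IncStr._I_ S d₁ n → IncStr._I_ S d₂ n →
      IncStr._I_ S d₁ m₁ → IncStr._I_ S d₂ m₂ →
      B' i d₁ → B' i d₂ → ¬ B'' i m₁ → ¬ B'' i m₂ →
      ∃[ p ] (IncStr._I_ S p m₁ × IncStr._I_ S p m₂))
lemma3p2 S _ _ Idx B' B'' F = outer-points-collinear F , outer-lines-concurrent F
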